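{- Let $A \in \mathbb{R}^{m\times n}$, $b\in\mathbb{R}^m$, and suppose $\mathcal{P}=\{x\in\mathbb{R}^n : Ax\geq b\}$ is a polytope (i.e., bounded) and that we are in the nondegenerate setting. Let $G=(V,E)$ be an undirected graph whose vertices are subsets of $[m]$. Suppose that all of the following hold: (i) $V$ is nonempty; (ii) every $I\in V$ is a feasible basis; (iii) for every $I\in V$ and every $J\in N_G(I)$, $\#(I\cap J) = n-1$; (iv) for every $I\in V$, $\# N_G(I) = n$. Then $G = G_{\mathrm{bases}}$.
   Context: $[m]=\{1,\dots,m\}$; for $I\subset[m]$, $A_I$ and $b_I$ denote the submatrix/subvector with rows indexed by $I$; $\#S$ is the cardinality of $S$; $N_G(I)$ is the set of neighbors of $I$ in $G$. A basis is a subset $I\subset[m]$ of cardinality $n$ such that $A_I$ is nonsingular; its basic point is the unique solution $x^I$ of $A_I x = b_I$. The basis is feasible if $x^I\in\mathcal{P}$. Two feasible bases $I,I'$ are adjacent if $\#(I\cap I')=n-1$; the graph of feasible bases $G_{\mathrm{bases}}$ has the feasible bases as vertices and this adjacency relation as edges. The nondegenerate setting means that the map $I\mapsto x^I$ from feasible bases to vertices of $\mathcal{P}$ is one-to-one, i.e., no vertex of $\mathcal{P}$ is the basic point of two distinct feasible bases. -}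

module Defs where

open import Level using (0ℓ)
open import Data.Nat using (ℕ; zero; suc)
open import Data.Bool using (Bool; true; false; T)
open import Data.Fin using (Fin; zero; suc)
open import Data.Fin.Subset using (Subset; _∈_; _∩_; ∣_∣)
open import Data.Vec using (Vec; []; _∷_)
open import Data.List using (List; []; _∷_; _++_; map; length)
open import Data.Product using (Σ; ∃; _×_; _,_)
open import Relation.Binary.PropositionalEquality using (_≡_; _≢_)
open import Relation.Binary.Structures using (IsTotalOrder)
open import Algebra.Structures using (IsCommutativeRing)

-- An ordered field (the paper works over ℝ, which is an instance;
-- the reals are not available in agda-stdlib).
record OrderedField : Set₁ where
  infixl 6 _+_
  infixl 7 _*_
  infix 4 _≤_
  field
    Carrier : Set
    _+_ _*_ : Carrier → Carrier → Carrier
    -_      : Carrier → Carrier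
    0# 1#   : Carrier
    _≤_     : Carrier → Carrier → Set
    isCommutativeRing : IsCommutativeRing _≡_ _+_ _*_ -_ 0# 1#
    isTotalOrder      : IsTotalOrder _≡_ _≤_
    0≢1     : 0# ≢ 1#
    inverse : ∀ x → x ≢ 0# → ∃ λ y → x * y ≡ 1#
    +-mono  : ∀ {x y} z → x ≤ y → x + z ≤ y + z
    *-pos   : ∀ {x y} → 0# ≤ x → 0# ≤ y → 0# ≤ x * y

module LP (F : OrderedField) where
  open OrderedField F public

  sumF : ∀ n → (Fin n → Carrier) → Carrier
  sumF zero    f = 0#
  sumF (suc n) f = f zero + sumF n (λ j → f (suc j))

  row· : ∀ {m n} → (Fin m → Fin n → Carrier) → (Fin n → Carrier) → Fin m → Carrier
  row· {n = n} A x i = sumF n (λ j → A i j * x j)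

  InP : ∀ {m n} → (Fin m → Fin n → Carrier) → (Fin m → Carrier) → (Fin n → Carrier) → Set
  InP A b x = ∀ i → b i ≤ row· A x i

  Bounded : ∀ {m n} → (Fin m → Fin n → Carrier) → (Fin m → Carrier) → Set
  Bounded {n = n} A b = Σ Carrier λ M → ∀ x → InP A b x → ∀ (j : Fin n) → (- M ≤ x j) × (x j ≤ M)

  NonsingularRows : ∀ {m n} → (Fin m → Fin n → Carrier) → Subset m → Set
  NonsingularRows A I = ∀ x → (∀ i → i ∈ I → row· A x i ≡ 0#) → ∀ j → x j ≡ 0#

  IsBasis : ∀ {m n} → (Fin m → Fin n → Carrier) → Subset m → Set
  IsBasis {n = n} A I = (∣ I ∣ ≡ n) × NonsingularRows A I

  BasicPoint : ∀ {m n} → (Fin m → Fin n → Carrier) → (Fin m → Carrier) → Subset m → (Fin n → Carrier) → Set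
  BasicPoint A b I x = ∀ i → i ∈ I → row· A x i ≡ b i

  FeasibleBasis : ∀ {m n} → (Fin m → Fin n → Carrier) → (Fin m → Carrier) → Subset m → Set
  FeasibleBasis A b I = IsBasis A I × (∃ λ x → BasicPoint A b I x × InP A b x)

  Nondegenerate : ∀ {m n} → (Fin m → Fin n → Carrier) → (Fin m → Carrier) → Set
  Nondegenerate A b = ∀ I I' x → FeasibleBasis A b I → FeasibleBasis A b I'
    → BasicPoint A b I x → BasicPoint A b I' x → I ≡ I'

allSubsets : ∀ m → List (Subset m)
allSubsets zero    = [] ∷ []
allSubsets (suc m) = map (true ∷_) (allSubsets m) ++ map (false ∷_) (allSubsets m)

countTrue : ∀ {A : Set} → (A → Bool) → List A → ℕ
countTrue p []       = 0
countTrue p (x ∷ xs) with p x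
... | true  = suc (countTrue p xs)
... | false = countTrue p xs

record SubsetGraph (m : ℕ) : Set where
  field
    V : Subset m → Bool
    E : Subset m → Subset m → Bool
    E-sym   : ∀ I J → E I J ≡ E J I
    E-in-V  : ∀ I J → T (E I J) → T (V I)

degree : ∀ {m} → SubsetGraph m → Subset m → ℕ
degree {m} G I = countTrue (SubsetGraph.E G I) (allSubsets m)

{-# OPTIONS --safe #-}
module Submission where

-- If feasible bases K, K′ arise from a feasible basis I by letting the same row i leave, their
-- basic points lie on the ray from x^I along which the other n − 1 rows of I stay tight, both at
-- the point where the ray leaves 𝒫; so they coincide and K = K′ by nondegeneracy.  Hence the n
-- neighbours of a vertex I of G leave through n distinct rows: every row of I is left along an
-- edge of G.  Given a feasible basis J, the linear objective ∑_{k ∈ J} A_k x is minimised over 𝒫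
-- exactly at x^J.  Let I be a vertex of G minimising it among the vertices of G.  The edges at I
-- span the cone A_I w ≥ 0, which contains x^J − x^I, so x^I is a minimiser as well and I = J by
-- nondegeneracy.  Thus every feasible basis is a vertex of G, and an adjacent pair I, J is an
-- edge of G: the unique edge leaving I through the row in I ∖ J.

open import Defs
open import Algebra.Bundles using (CommutativeRing)
open import Algebra.Structures using (IsCommutativeRing)
open import Data.Bool using (T)
open import Data.Fin using (Fin; zero; suc; punchIn)
open import Data.Fin.Subset using (Subset; _∈_; _∩_; ∣_∣)
open import Data.Nat using (zero; suc)
open import Data.Product using (∃; _×_; _,_; proj₁; proj₂)
open import Data.Sum using (inj₁; inj₂)
open import Data.Vec.Functional using (Vector; removeAt)
open import Function using (_∘_)
open import Function.Bundles using (_⇔_; mk⇔)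
open import Relation.Binary.Bundles using (Poset; TotalOrder)
open import Relation.Binary.PropositionalEquality using (_≡_; _≢_; _≗_; refl; sym; trans; cong; cong₂; subst)
open import Relation.Nullary using (¬_; Dec; yes; no; contradiction)

module OrderedFieldProperties (F : OrderedField) where
  open OrderedField F public
  open IsCommutativeRing isCommutativeRing public
    using (_-_; +-assoc; +-comm; *-assoc; *-comm; distribˡ; zeroˡ; zeroʳ;
           +-identityˡ; +-identityʳ; *-identityˡ; *-identityʳ; -‿inverseˡ; -‿inverseʳ)
  open import Relation.Binary.Structures using (IsTotalOrder)
  open IsTotalOrder isTotalOrder public using (total; antisym)
    renaming (refl to ≤-refl; reflexive to ≤-reflexive)

  commutativeRing : CommutativeRing _ _
  commutativeRing = record { isCommutativeRing = isCommutativeRing }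

  ≤-poset : Poset _ _ _
  ≤-poset = record { isPartialOrder = IsTotalOrder.isPartialOrder isTotalOrder }

  ≤-totalOrder : TotalOrder _ _ _
  ≤-totalOrder = record { isTotalOrder = isTotalOrder }

  open CommutativeRing commutativeRing public using (ring)
  open import Algebra.Properties.Ring ring public
    using (-‿distribʳ-*; -‿involutive; -1*x≈-x; x[y-z]≈xy-xz; [y-z]x≈yx-zx;
           x∙y⁻¹≈ε⇒x≈y; x≈y⇒x∙y⁻¹≈ε; ⁻¹-anti-homo‿-; +-cancelʳ)
  open import Algebra.Properties.CommutativeSemigroup (CommutativeRing.*-commutativeSemigroup commutativeRing) public
    using (x∙yz≈y∙xz)
  open import Relation.Binary.Reasoning.PartialOrder ≤-poset public

  +-monoʳ-≤ : ∀ {x y} z → x ≤ y → z + x ≤ z + y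
  +-monoʳ-≤ {x} {y} z x≤y = begin
    z + x ≡⟨ +-comm z x ⟩
    x + z ≤⟨ +-mono z x≤y ⟩
    y + z ≡⟨ +-comm y z ⟩
    z + y ∎

  x≤y⇒0≤y-x : ∀ {x y} → x ≤ y → 0# ≤ y - x
  x≤y⇒0≤y-x {x} {y} x≤y = begin
    0#    ≡⟨ -‿inverseʳ x ⟨
    x - x ≤⟨ +-mono (- x) x≤y ⟩
    y - x ∎

  0≤y-x⇒x≤y : ∀ {x y} → 0# ≤ y - x → x ≤ y
  0≤y-x⇒x≤y {x} {y} 0≤y-x = begin
    x             ≡⟨ +-identityˡ x ⟨
    0# + x        ≤⟨ +-mono x 0≤y-x ⟩
    y - x + x     ≡⟨ +-assoc y (- x) x ⟩
    y + (- x + x) ≡⟨ cong (y +_) (-‿inverseˡ x) ⟩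
    y + 0#        ≡⟨ +-identityʳ y ⟩
    y             ∎

  x≤0⇒0≤-x : ∀ {x} → x ≤ 0# → 0# ≤ - x
  x≤0⇒0≤-x {x} x≤0 = subst (0# ≤_) (+-identityˡ (- x)) (x≤y⇒0≤y-x x≤0)

  0≤-x⇒x≤0 : ∀ {x} → 0# ≤ - x → x ≤ 0#
  0≤-x⇒x≤0 {x} 0≤-x = 0≤y-x⇒x≤y (subst (0# ≤_) (sym (+-identityˡ (- x))) 0≤-x)

  *-monoˡ-≤-nonNeg : ∀ {c x y} → 0# ≤ c → x ≤ y → c * x ≤ c * y
  *-monoˡ-≤-nonNeg {c} {x} {y} 0≤c x≤y =
    0≤y-x⇒x≤y (subst (0# ≤_) (x[y-z]≈xy-xz c y x) (*-pos 0≤c (x≤y⇒0≤y-x x≤y)))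

  0≤1 : 0# ≤ 1#
  0≤1 with total 0# 1#
  ... | inj₁ 0≤1 = 0≤1
  ... | inj₂ 1≤0 = contradiction (antisym (subst (0# ≤_) -1*-1≡1 0≤-1*-1) 1≤0) 0≢1
    where
      0≤-1*-1 : 0# ≤ - 1# * - 1#
      0≤-1*-1 = *-pos (x≤0⇒0≤-x 1≤0) (x≤0⇒0≤-x 1≤0)
      -1*-1≡1 : - 1# * - 1# ≡ 1#
      -1*-1≡1 = trans (-1*x≈-x (- 1#)) (-‿involutive 1#)

  *-cancelˡ-≢0 : ∀ {a c} → a ≢ 0# → a * c ≡ 0# → c ≡ 0#
  *-cancelˡ-≢0 {a} {c} a≢0 ac≡0 with inverse a a≢0
  ... | a⁻¹ , aa⁻¹≡1 = begin-equality
    c               ≡⟨ *-identityˡ c ⟨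
    1# * c          ≡⟨ cong (_* c) aa⁻¹≡1 ⟨
    a * a⁻¹ * c     ≡⟨ cong (_* c) (*-comm a a⁻¹) ⟩
    a⁻¹ * a * c     ≡⟨ *-assoc a⁻¹ a c ⟩
    a⁻¹ * (a * c)   ≡⟨ cong (a⁻¹ *_) ac≡0 ⟩
    a⁻¹ * 0#        ≡⟨ zeroʳ a⁻¹ ⟩
    0#              ∎

  inverse-nonNeg : ∀ {a c} → 0# ≤ a → a * c ≡ 1# → 0# ≤ c
  inverse-nonNeg {a} {c} 0≤a ac≡1 with total 0# c
  ... | inj₁ 0≤c = 0≤c
  ... | inj₂ c≤0 = contradiction (antisym 0≤1 (0≤-x⇒x≤0 0≤-1)) 0≢1
    where
      0≤-1 : 0# ≤ - 1#
      0≤-1 = subst (0# ≤_) (trans (sym (-‿distribʳ-* a c)) (cong -_ ac≡1)) (*-pos 0≤a (x≤0⇒0≤-x c≤0))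

  *-cancelʳ-≤-neg : ∀ {a p q} → a ≤ 0# → a ≢ 0# → p * a ≤ q * a → q ≤ p
  *-cancelʳ-≤-neg {a} {p} {q} a≤0 a≢0 pa≤qa with total q p
  ... | inj₁ q≤p = q≤p
  ... | inj₂ p≤q = ≤-reflexive (sym p≡q)
    where
      qa≤pa : q * a ≤ p * a
      qa≤pa = 0≤y-x⇒x≤y (subst (0# ≤_) [q-p][-a]≡pa-qa (*-pos (x≤y⇒0≤y-x p≤q) (x≤0⇒0≤-x a≤0)))
        where
          [q-p][-a]≡pa-qa : (q - p) * - a ≡ p * a - q * a
          [q-p][-a]≡pa-qa = begin-equality
            (q - p) * - a       ≡⟨ -‿distribʳ-* (q - p) a ⟨
            - ((q - p) * a)     ≡⟨ cong -_ ([y-z]x≈yx-zx a q p) ⟩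
            - (q * a - p * a)   ≡⟨ ⁻¹-anti-homo‿- (q * a) (p * a) ⟩
            p * a - q * a       ∎
      p≡q : p ≡ q
      p≡q = x∙y⁻¹≈ε⇒x≈y p q (*-cancelˡ-≢0 a≢0 (begin-equality
        a * (p - q)         ≡⟨ *-comm a (p - q) ⟩
        (p - q) * a         ≡⟨ [y-z]x≈yx-zx a p q ⟩
        p * a - q * a       ≡⟨ x≈y⇒x∙y⁻¹≈ε (antisym pa≤qa qa≤pa) ⟩
        0#                  ∎))

module LinearAlgebra (F : OrderedField) where
  open OrderedFieldProperties F
  open LP F using (sumF; row·; NonsingularRows)
  open import Algebra.Properties.Semiring.Sum (CommutativeRing.semiring commutativeRing) public
    using (sum; sum-cong-≗; ∑-distrib-+; *-distribˡ-sum; sum-remove; sum-replicate-zero)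
  open import Data.Fin.Properties using (punchInᵢ≢i)

  infixl 6 _+ᵥ_ _-ᵥ_
  infixr 7 _*ₗ_

  0ᵥ : ∀ {n} → Vector Carrier n
  0ᵥ _ = 0#

  _+ᵥ_ _-ᵥ_ : ∀ {n} → Vector Carrier n → Vector Carrier n → Vector Carrier n
  (x +ᵥ y) t = x t + y t
  (x -ᵥ y) t = x t - y t

  _*ₗ_ : ∀ {n} → Carrier → Vector Carrier n → Vector Carrier n
  (c *ₗ x) t = c * x t

  ∑ᵥ : ∀ {M n} → Vector (Vector Carrier n) M → Vector Carrier n
  ∑ᵥ v t = sum (λ l → v l t)

  sumF≡sum : ∀ n (f : Vector Carrier n) → sumF n f ≡ sum f
  sumF≡sum zero    f = refl
  sumF≡sum (suc n) f = cong (f zero +_) (sumF≡sum n (λ j → f (suc j)))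

  sum-nonNeg : ∀ {M} (g : Vector Carrier M) → (∀ k → 0# ≤ g k) → 0# ≤ sum g
  sum-nonNeg {zero}  g 0≤g = ≤-refl
  sum-nonNeg {suc M} g 0≤g = begin
    0#                             ≡⟨ +-identityʳ 0# ⟨
    0# + 0#                        ≤⟨ +-mono 0# (0≤g zero) ⟩
    g zero + 0#                    ≤⟨ +-monoʳ-≤ (g zero) (sum-nonNeg (λ k → g (suc k)) (λ k → 0≤g (suc k))) ⟩
    g zero + sum (λ k → g (suc k)) ∎

  sum-nonNeg-≡0 : ∀ {M} (g : Vector Carrier M) → (∀ k → 0# ≤ g k) → sum g ≡ 0# → ∀ k → g k ≡ 0#
  sum-nonNeg-≡0 {suc M} g 0≤g ∑g≡0 k = antisym gk≤0 (0≤g k)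
    where
      gk≤0 : g k ≤ 0#
      gk≤0 = begin
        g k                         ≡⟨ +-identityʳ (g k) ⟨
        g k + 0#                    ≤⟨ +-monoʳ-≤ (g k) (sum-nonNeg _ (λ l → 0≤g (punchIn k l))) ⟩
        g k + sum (removeAt g k)    ≡⟨ sum-remove g ⟨
        sum g                       ≡⟨ ∑g≡0 ⟩
        0#                          ∎

  sum-onePoint : ∀ {M} (g : Vector Carrier M) k → (∀ l → l ≢ k → g l ≡ 0#) → sum g ≡ g k
  sum-onePoint {suc M} g k g≡0 = begin-equality
    sum g                       ≡⟨ sum-remove g ⟩
    g k + sum (removeAt g k)    ≡⟨ cong (g k +_) (sum-cong-≗ (λ l → g≡0 (punchIn k l) (punchInᵢ≢i k l))) ⟩
    g k + sum {M} (λ _ → 0#)    ≡⟨ cong (g k +_) (sum-replicate-zero M) ⟩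
    g k + 0#                    ≡⟨ +-identityʳ (g k) ⟩
    g k                         ∎

  record IsLinear {n} (φ : Vector Carrier n → Carrier) : Set where
    field
      cong-≗  : ∀ {x y} → x ≗ y → φ x ≡ φ y
      +-homo  : ∀ x y → φ (x +ᵥ y) ≡ φ x + φ y
      *ₗ-homo : ∀ c x → φ (c *ₗ x) ≡ c * φ x

    0-homo : φ 0ᵥ ≡ 0#
    0-homo = begin-equality
      φ 0ᵥ          ≡⟨ cong-≗ (λ _ → zeroˡ 0#) ⟨
      φ (0# *ₗ 0ᵥ)  ≡⟨ *ₗ-homo 0# 0ᵥ ⟩
      0# * φ 0ᵥ     ≡⟨ zeroˡ (φ 0ᵥ) ⟩
      0#            ∎

    -ᵥ-homo : ∀ x y → φ (x -ᵥ y) ≡ φ x - φ y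
    -ᵥ-homo x y = begin-equality
      φ (x -ᵥ y)              ≡⟨ cong-≗ (λ t → cong (x t +_) (-1*x≈-x (y t))) ⟨
      φ (x +ᵥ - 1# *ₗ y)      ≡⟨ +-homo x (- 1# *ₗ y) ⟩
      φ x + φ (- 1# *ₗ y)     ≡⟨ cong (φ x +_) (*ₗ-homo (- 1#) y) ⟩
      φ x + - 1# * φ y        ≡⟨ cong (φ x +_) (-1*x≈-x (φ y)) ⟩
      φ x - φ y               ∎

    ∑ᵥ-homo : ∀ {M} (v : Vector (Vector Carrier n) M) → φ (∑ᵥ v) ≡ sum (λ l → φ (v l))
    ∑ᵥ-homo {zero}  v = 0-homo
    ∑ᵥ-homo {suc M} v = trans (+-homo (v zero) (∑ᵥ (λ l → v (suc l))))
                              (cong (φ (v zero) +_) (∑ᵥ-homo (λ l → v (suc l))))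

  open IsLinear public

  isLinear-resp : ∀ {n} {φ ψ : Vector Carrier n → Carrier} → (∀ x → φ x ≡ ψ x) → IsLinear φ → IsLinear ψ
  isLinear-resp {φ = φ} {ψ} φ≡ψ lin = record
    { cong-≗  = λ {x} {y} x≗y → trans (sym (φ≡ψ x)) (trans (cong-≗ lin x≗y) (φ≡ψ y))
    ; +-homo  = λ x y → trans (sym (φ≡ψ (x +ᵥ y))) (trans (+-homo lin x y) (cong₂ _+_ (φ≡ψ x) (φ≡ψ y)))
    ; *ₗ-homo = λ c x → trans (sym (φ≡ψ (c *ₗ x))) (trans (*ₗ-homo lin c x) (cong (c *_) (φ≡ψ x)))
    }

  coordinate-isLinear : ∀ {n} (j : Fin n) → IsLinear (λ x → x j)
  coordinate-isLinear j = record { cong-≗ = λ x≗y → x≗y j ; +-homo = λ _ _ → refl ; *ₗ-homo = λ _ _ → refl }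

  weightedSum-isLinear : ∀ {M n} (c : Vector Carrier M) {φ : Fin M → Vector Carrier n → Carrier} →
                         (∀ k → IsLinear (φ k)) → IsLinear (λ x → sum (λ k → c k * φ k x))
  weightedSum-isLinear c {φ} lin = record
    { cong-≗  = λ x≗y → sum-cong-≗ (λ k → cong (c k *_) (cong-≗ (lin k) x≗y))
    ; +-homo  = λ x y → trans (sum-cong-≗ (λ k → trans (cong (c k *_) (+-homo (lin k) x y))
                                                       (distribˡ (c k) (φ k x) (φ k y))))
                              (∑-distrib-+ (λ k → c k * φ k x) (λ k → c k * φ k y))
    ; *ₗ-homo = λ d x → trans (sum-cong-≗ (λ k → trans (cong (c k *_) (*ₗ-homo (lin k) d x))
                                                       (x∙yz≈y∙xz (c k) d (φ k x))))
                              (sym (*-distribˡ-sum d (λ k → c k * φ k x)))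
    }

  row·-isLinear : ∀ {m n} (A : Fin m → Fin n → Carrier) k → IsLinear (λ x → row· A x k)
  row·-isLinear {n = n} A k =
    isLinear-resp (λ x → sym (sumF≡sum n _)) (weightedSum-isLinear (A k) coordinate-isLinear)

  nonsingular⇒injective : ∀ {m n} {A : Fin m → Fin n → Carrier} {I} → NonsingularRows A I →
                          ∀ {x y} → (∀ i → i ∈ I → row· A x i ≡ row· A y i) → x ≗ y
  nonsingular⇒injective {A = A} ns {x} {y} Ax≡Ay t = x∙y⁻¹≈ε⇒x≈y (x t) (y t)
    (ns (x -ᵥ y) (λ i i∈I → trans (-ᵥ-homo (row·-isLinear A i) x y) (x≈y⇒x∙y⁻¹≈ε (Ax≡Ay i i∈I))) t)

module SubsetCombinatorics where
  open import Data.Nat using (_≤_; s≤s; z≤n)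
  open import Data.Nat.Properties using (≤-trans; 1+n≰n; suc-injective)
  open import Data.Bool using (Bool; true; false; T?)
  open import Data.Fin.Subset using (_∉_; _⊆_; _∩_; _-_; ∣_∣)
  open import Data.Fin.Subset.Properties using (∣p∩q∣≤∣p∣; x∈p∧x≢y⇒x∈p-y; x∈p⇒∣p-x∣<∣p∣; ∩-comm)
  open import Data.Vec using ([]; _∷_; here; there; tail)
  open import Data.List using (List; []; _∷_; map; length; filter)
  open import Data.List.Relation.Unary.All as All using (All; []; _∷_)
  open import Data.List.Relation.Unary.AllPairs using (AllPairs; []; _∷_)
  import Data.List.Relation.Unary.AllPairs as AllPairs
  import Data.List.Relation.Unary.AllPairs.Properties as AllPairs
  import Data.List.Relation.Unary.All.Properties as All
  open import Data.List.Relation.Unary.Any using (here)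
  open import Data.List.Membership.Propositional using () renaming (_∈_ to _∈ₗ_)
  open import Data.List.Membership.Propositional.Properties using (∈-++⁺ˡ; ∈-++⁺ʳ; ∈-map⁺)
  open import Data.Empty using (⊥-elim)

  ∣p∩q∣≡∣p∣⇒p⊆q : ∀ {m} (p q : Subset m) → ∣ p ∩ q ∣ ≡ ∣ p ∣ → p ⊆ q
  ∣p∩q∣≡∣p∣⇒p⊆q (true  ∷ p) (true  ∷ q) eq here      = here
  ∣p∩q∣≡∣p∣⇒p⊆q (true  ∷ p) (true  ∷ q) eq (there x) = there (∣p∩q∣≡∣p∣⇒p⊆q p q (suc-injective eq) x)
  ∣p∩q∣≡∣p∣⇒p⊆q (true  ∷ p) (false ∷ q) eq _         = ⊥-elim (1+n≰n (subst (_≤ ∣ p ∣) eq (∣p∩q∣≤∣p∣ p q)))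
  ∣p∩q∣≡∣p∣⇒p⊆q (false ∷ p) (_     ∷ q) eq (there x) = there (∣p∩q∣≡∣p∣⇒p⊆q p q eq x)

  infix 4 _─_≡⁅_⁆

  _─_≡⁅_⁆ : ∀ {m} → Subset m → Subset m → Fin m → Set
  p ─ q ≡⁅ i ⁆ = i ∈ p × i ∉ q × (∀ {l} → l ∈ p → l ∉ q → l ≡ i)

  ∷-─≡⁅suc⁆ : ∀ {m s t} {p q : Subset m} {i} → (zero ∈ s ∷ p → zero ∈ t ∷ q) →
              p ─ q ≡⁅ i ⁆ → s ∷ p ─ t ∷ q ≡⁅ suc i ⁆
  ∷-─≡⁅suc⁆ zero-∉ (i∈p , i∉q , only-i) = there i∈p , (λ { (there i∈q) → i∉q i∈q }) , λ
    { here        l∉q → ⊥-elim (l∉q (zero-∉ here))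
    ; (there l∈p) l∉q → cong suc (only-i l∈p (l∉q ∘ there)) }

  ∣p∣≡1+∣p∩q∣⇒p─q≡⁅i⁆ : ∀ {m} (p q : Subset m) → ∣ p ∣ ≡ suc ∣ p ∩ q ∣ → ∃ λ i → p ─ q ≡⁅ i ⁆
  ∣p∣≡1+∣p∩q∣⇒p─q≡⁅i⁆ []          []          ()
  ∣p∣≡1+∣p∩q∣⇒p─q≡⁅i⁆ (true  ∷ p) (false ∷ q) eq = zero , here , (λ ()) , λ
    { here        _   → refl
    ; (there l∈p) l∉q → ⊥-elim (l∉q (there (∣p∩q∣≡∣p∣⇒p⊆q p q (sym (suc-injective eq)) l∈p))) }
  ∣p∣≡1+∣p∩q∣⇒p─q≡⁅i⁆ (true  ∷ p) (true  ∷ q) eq with ∣p∣≡1+∣p∩q∣⇒p─q≡⁅i⁆ p q (suc-injective eq)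
  ... | i , p─q≡⁅i⁆ = suc i , ∷-─≡⁅suc⁆ (λ _ → here) p─q≡⁅i⁆
  ∣p∣≡1+∣p∩q∣⇒p─q≡⁅i⁆ (false ∷ p) (_     ∷ q) eq with ∣p∣≡1+∣p∩q∣⇒p─q≡⁅i⁆ p q eq
  ... | i , p─q≡⁅i⁆ = suc i , ∷-─≡⁅suc⁆ (λ ()) p─q≡⁅i⁆

  ─≡⁅⁆-witness : ∀ {m} {p q : Subset m} {i l} → p ─ q ≡⁅ i ⁆ → l ∈ p → l ∉ q → p ─ q ≡⁅ l ⁆
  ─≡⁅⁆-witness (_ , _ , only-i) l∈p l∉q =
    l∈p , l∉q , λ l′∈p l′∉q → trans (only-i l′∈p l′∉q) (sym (only-i l∈p l∉q))

  adjacent⇒exchange : ∀ {m n} {I K : Subset m} {i} → ∣ I ∣ ≡ n → ∣ K ∣ ≡ n → suc ∣ I ∩ K ∣ ≡ n →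
                      i ∈ I → i ∉ K → I ─ K ≡⁅ i ⁆ × ∃ (K ─ I ≡⁅_⁆)
  adjacent⇒exchange {I = I} {K} ∣I∣≡n ∣K∣≡n 1+∣I∩K∣≡n i∈I i∉K =
    ─≡⁅⁆-witness (proj₂ (∣p∣≡1+∣p∩q∣⇒p─q≡⁅i⁆ I K (trans ∣I∣≡n (sym 1+∣I∩K∣≡n)))) i∈I i∉K ,
    ∣p∣≡1+∣p∩q∣⇒p─q≡⁅i⁆ K I (trans ∣K∣≡n (trans (sym 1+∣I∩K∣≡n) (cong (suc ∘ ∣_∣) (∩-comm I K))))

  pigeonhole-length≤∣S∣ : ∀ {A : Set} {m} (S : Subset m) (R : A → Fin m → Set) {xs : List A} →
               AllPairs _≢_ xs → All (λ x → ∃ λ i → i ∈ S × R x i) xs →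
               (∀ {x y i} → R x i → R y i → x ≡ y) → length xs ≤ ∣ S ∣
  pigeonhole-length≤∣S∣ S R []            []                       R-inj = z≤n
  pigeonhole-length≤∣S∣ S R (x∉xs ∷ xs!) ((i , i∈S , Rxi) ∷ hyps) R-inj =
    ≤-trans (s≤s (pigeonhole-length≤∣S∣ (S - i) R xs! (All.zipWith avoid-i (x∉xs , hyps)) R-inj))
            (x∈p⇒∣p-x∣<∣p∣ i∈S)
    where
      avoid-i : ∀ {y} → _ ≢ y × (∃ λ l → l ∈ S × R y l) → ∃ λ l → l ∈ S - i × R y l
      avoid-i (x≢y , l , l∈S , Ryl) = l , x∈p∧x≢y⇒x∈p-y l∈S (λ { refl → x≢y (R-inj Rxi Ryl) }) , Ryl

  allSubsets-complete : ∀ {m} (p : Subset m) → p ∈ₗ allSubsets m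
  allSubsets-complete []                = here refl
  allSubsets-complete {suc m} (true ∷ p)  = ∈-++⁺ˡ (∈-map⁺ (true ∷_) (allSubsets-complete p))
  allSubsets-complete {suc m} (false ∷ p) = ∈-++⁺ʳ _ (∈-map⁺ (false ∷_) (allSubsets-complete p))

  allSubsets-distinct : ∀ m → AllPairs _≢_ (allSubsets m)
  allSubsets-distinct zero    = [] ∷ []
  allSubsets-distinct (suc m) = AllPairs.++⁺ (∷-distinct true) (∷-distinct false)
    (All.map⁺ (All.universal (λ _ → All.map⁺ (All.universal (λ _ ()) (allSubsets m))) (allSubsets m)))
    where
      ∷-distinct : ∀ b → AllPairs _≢_ (map (b ∷_) (allSubsets m))
      ∷-distinct b = AllPairs.map⁺ (AllPairs.map (λ p≢q → p≢q ∘ cong tail) (allSubsets-distinct m))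

  countTrue≡length∘filter : ∀ {A : Set} (p : A → Bool) xs → countTrue p xs ≡ length (filter (T? ∘ p) xs)
  countTrue≡length∘filter p []       = refl
  countTrue≡length∘filter p (x ∷ xs) with p x
  ... | true  = cong suc (countTrue≡length∘filter p xs)
  ... | false = countTrue≡length∘filter p xs

module FeasibleBases (F : OrderedField) {m n} (A : Fin m → Fin n → OrderedField.Carrier F)
                (b : Fin m → OrderedField.Carrier F) where
  open OrderedFieldProperties F
  open LinearAlgebra F
  open LP F using (row·; InP; BasicPoint; NonsingularRows; FeasibleBasis; Nondegenerate)
  open SubsetCombinatorics using (_─_≡⁅_⁆)
  open import Data.Fin.Subset using (_∉_)
  open import Data.Fin.Subset.Properties using (_∈?_)
  open import Data.Fin.Properties using () renaming (_≟_ to _≟ᶠ_)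

  infix 25 A[_]·_
  A[_]·_ : Fin m → Vector Carrier n → Carrier
  A[ k ]· x = row· A x k

  point : ∀ {I} → FeasibleBasis A b I → Vector Carrier n
  point (_ , x , _) = x

  point-basic : ∀ {I} (fbI : FeasibleBasis A b I) → BasicPoint A b I (point fbI)
  point-basic (_ , _ , basic , _) = basic

  point-feasible : ∀ {I} (fbI : FeasibleBasis A b I) → InP A b (point fbI)
  point-feasible (_ , _ , _ , feasible) = feasible

  nonsingular : ∀ {I} → FeasibleBasis A b I → NonsingularRows A I
  nonsingular ((_ , ns) , _) = ns

  BasicPoint-resp-≗ : ∀ {K x y} → x ≗ y → BasicPoint A b K x → BasicPoint A b K y
  BasicPoint-resp-≗ x≗y basic k k∈K = trans (sym (cong-≗ (row·-isLinear A k) x≗y)) (basic k k∈K)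

  point-injective : Nondegenerate A b → ∀ {I K} (fbI : FeasibleBasis A b I) (fbK : FeasibleBasis A b K) →
                    point fbI ≗ point fbK → I ≡ K
  point-injective nondeg {I} {K} fbI fbK x≗y =
    nondeg I K (point fbI) fbI fbK (point-basic fbI) (BasicPoint-resp-≗ (sym ∘ x≗y) (point-basic fbK))

  A·-combination : ∀ k c d (u v : Vector Carrier n) → A[ k ]· (c *ₗ u -ᵥ d *ₗ v) ≡ c * A[ k ]· u - d * A[ k ]· v
  A·-combination k c d u v = trans (-ᵥ-homo lin (c *ₗ u) (d *ₗ v)) (cong₂ _-_ (*ₗ-homo lin c u) (*ₗ-homo lin d v))
    where lin = row·-isLinear A k

  -- n − 1 independent rows leave a one-dimensional kernel
  proportional : ∀ {I i} → NonsingularRows A I → ∀ {u v : Vector Carrier n} →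
                 (∀ {l} → l ∈ I → l ≢ i → A[ l ]· u ≡ 0#) → (∀ {l} → l ∈ I → l ≢ i → A[ l ]· v ≡ 0#) →
                 ∀ t → (A[ i ]· v *ₗ u -ᵥ A[ i ]· u *ₗ v) t ≡ 0#
  proportional {I} {i} ns {u} {v} u-tight v-tight = ns _ vanishes
    where
      vanishes : ∀ l → l ∈ I → A[ l ]· (A[ i ]· v *ₗ u -ᵥ A[ i ]· u *ₗ v) ≡ 0#
      vanishes l l∈I with l ≟ᶠ i
      ... | yes refl = trans (A·-combination l _ _ u v) (x≈y⇒x∙y⁻¹≈ε (*-comm (A[ l ]· v) (A[ l ]· u)))
      ... | no l≢i   = begin-equality
        A[ l ]· (A[ i ]· v *ₗ u -ᵥ A[ i ]· u *ₗ v)    ≡⟨ A·-combination l _ _ u v ⟩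
        A[ i ]· v * A[ l ]· u - A[ i ]· u * A[ l ]· v  ≡⟨ cong₂ (λ p q → A[ i ]· v * p - A[ i ]· u * q) (u-tight l∈I l≢i) (v-tight l∈I l≢i) ⟩
        A[ i ]· v * 0# - A[ i ]· u * 0#               ≡⟨ cong₂ _-_ (zeroʳ _) (zeroʳ _) ⟩
        0# - 0#                                       ≡⟨ -‿inverseʳ 0# ⟩
        0#                                            ∎

  edge : ∀ {I K} → FeasibleBasis A b I → FeasibleBasis A b K → Vector Carrier n
  edge fbI fbK = point fbK -ᵥ point fbI

  module _ {I K} (fbI : FeasibleBasis A b I) (fbK : FeasibleBasis A b K) where
    private
      x = point fbI
      y = point fbK
      u = edge fbI fbK

    A·edge : ∀ k → A[ k ]· u ≡ A[ k ]· y - A[ k ]· x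
    A·edge k = -ᵥ-homo (row·-isLinear A k) y x

    edge-tight : ∀ {l} → l ∈ I → l ∈ K → A[ l ]· u ≡ 0#
    edge-tight {l} l∈I l∈K = trans (A·edge l) (x≈y⇒x∙y⁻¹≈ε (trans (point-basic fbK l l∈K) (sym (point-basic fbI l l∈I))))

    edge-nonNeg : ∀ {l} → l ∈ I → 0# ≤ A[ l ]· u
    edge-nonNeg {l} l∈I = subst (0# ≤_) (sym (A·edge l))
      (x≤y⇒0≤y-x (subst (_≤ A[ l ]· y) (sym (point-basic fbI l l∈I)) (point-feasible fbK l)))

    edge-nonPos : ∀ {l} → l ∈ K → A[ l ]· u ≤ 0#
    edge-nonPos {l} l∈K = 0≤-x⇒x≤0 (subst (0# ≤_) (sym (trans (cong -_ (A·edge l)) (⁻¹-anti-homo‿- _ _)))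
      (x≤y⇒0≤y-x (subst (_≤ A[ l ]· x) (sym (point-basic fbK l l∈K)) (point-feasible fbI l))))

    edge-tight-except : ∀ {i l} → I ─ K ≡⁅ i ⁆ → l ∈ I → l ≢ i → A[ l ]· u ≡ 0#
    edge-tight-except {l = l} (_ , _ , only-i) l∈I l≢i with l ∈? K
    ... | yes l∈K = edge-tight l∈I l∈K
    ... | no  l∉K = contradiction (only-i l∈I l∉K) l≢i

    module _ (nondeg : Nondegenerate A b) {i} (I─K≡⁅i⁆ : I ─ K ≡⁅ i ⁆) where
      private
        edge-∉-kernel : ∀ {L} → NonsingularRows A L → ¬ (∀ l → l ∈ L → A[ l ]· u ≡ 0#)
        edge-∉-kernel ns u-tight = proj₁ (proj₂ I─K≡⁅i⁆) (subst (i ∈_) I≡K (proj₁ I─K≡⁅i⁆))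
          where
            I≡K : I ≡ K
            I≡K = point-injective nondeg fbI fbK (λ t → sym (x∙y⁻¹≈ε⇒x≈y (y t) (x t) (ns u u-tight t)))

      edge-leaving-≢0 : A[ i ]· u ≢ 0#
      edge-leaving-≢0 Aᵢu≡0 = edge-∉-kernel (nonsingular fbI) tight
        where
          tight : ∀ l → l ∈ I → A[ l ]· u ≡ 0#
          tight l l∈I with l ≟ᶠ i
          ... | yes refl = Aᵢu≡0
          ... | no  l≢i  = edge-tight-except I─K≡⁅i⁆ l∈I l≢i

      edge-entering-≢0 : ∀ {j} → K ─ I ≡⁅ j ⁆ → A[ j ]· u ≢ 0#
      edge-entering-≢0 {j} (_ , _ , only-j) Aⱼu≡0 = edge-∉-kernel (nonsingular fbK) tight
        where
          tight : ∀ l → l ∈ K → A[ l ]· u ≡ 0#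
          tight l l∈K with l ∈? I
          ... | yes l∈I = edge-tight l∈I l∈K
          ... | no  l∉I = subst (λ l → A[ l ]· u ≡ 0#) (sym (only-j l∈K l∉I)) Aⱼu≡0

  module _ (nondeg : Nondegenerate A b) {I} {i : Fin m} (fbI : FeasibleBasis A b I) where
    private
      proportional-edges : ∀ {K K′} (fbK : FeasibleBasis A b K) (fbK′ : FeasibleBasis A b K′) →
                           I ─ K ≡⁅ i ⁆ → I ─ K′ ≡⁅ i ⁆ → ∀ t →
                           (A[ i ]· edge fbI fbK′ *ₗ edge fbI fbK -ᵥ A[ i ]· edge fbI fbK *ₗ edge fbI fbK′) t ≡ 0#
      proportional-edges fbK fbK′ I─K≡⁅i⁆ I─K′≡⁅i⁆ =
        proportional (nonsingular fbI) (edge-tight-except fbI fbK I─K≡⁅i⁆) (edge-tight-except fbI fbK′ I─K′≡⁅i⁆)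

    -- u′ is a multiple of u, and the row j in which y stops forbids y′ to go any further.
    edge-leaving-≤ : ∀ {K K′ j} (fbK : FeasibleBasis A b K) (fbK′ : FeasibleBasis A b K′) →
                     I ─ K ≡⁅ i ⁆ → K ─ I ≡⁅ j ⁆ → I ─ K′ ≡⁅ i ⁆ →
                     A[ i ]· edge fbI fbK′ ≤ A[ i ]· edge fbI fbK
    edge-leaving-≤ {j = j} fbK fbK′ I─K≡⁅i⁆ K─I≡⁅j⁆ I─K′≡⁅i⁆ =
      *-cancelʳ-≤-neg (edge-nonPos fbI fbK j∈K) (edge-entering-≢0 fbI fbK nondeg I─K≡⁅i⁆ K─I≡⁅j⁆) αa≤α′a
      where
        u = edge fbI fbK
        u′ = edge fbI fbK′
        α = A[ i ]· u
        α′ = A[ i ]· u′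
        a = A[ j ]· u
        a′ = A[ j ]· u′
        j∈K = proj₁ K─I≡⁅j⁆
        Aⱼ = row·-isLinear A j

        α′a≡αa′ : α′ * a ≡ α * a′
        α′a≡αa′ = x∙y⁻¹≈ε⇒x≈y _ _ (begin-equality
          α′ * a - α * a′              ≡⟨ A·-combination j α′ α u u′ ⟨
          A[ j ]· (α′ *ₗ u -ᵥ α *ₗ u′)  ≡⟨ cong-≗ Aⱼ (proportional-edges fbK fbK′ I─K≡⁅i⁆ I─K′≡⁅i⁆) ⟩
          A[ j ]· 0ᵥ                   ≡⟨ 0-homo Aⱼ ⟩
          0#                           ∎)

        a≤a′ : a ≤ a′
        a≤a′ = begin
          a                                      ≡⟨ A·edge fbI fbK j ⟩
          A[ j ]· point fbK - A[ j ]· point fbI  ≡⟨ cong (_- A[ j ]· point fbI) (point-basic fbK j j∈K) ⟩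
          b j - A[ j ]· point fbI                ≤⟨ +-mono (- A[ j ]· point fbI) (point-feasible fbK′ j) ⟩
          A[ j ]· point fbK′ - A[ j ]· point fbI ≡⟨ A·edge fbI fbK′ j ⟨
          a′                                     ∎

        αa≤α′a : α * a ≤ α′ * a
        αa≤α′a = begin
          α * a   ≤⟨ *-monoˡ-≤-nonNeg (edge-nonNeg fbI fbK (proj₁ I─K≡⁅i⁆)) a≤a′ ⟩
          α * a′  ≡⟨ α′a≡αa′ ⟨
          α′ * a  ∎

    edge-unique : ∀ {K K′ j j′} (fbK : FeasibleBasis A b K) (fbK′ : FeasibleBasis A b K′) →
                  I ─ K ≡⁅ i ⁆ → K ─ I ≡⁅ j ⁆ → I ─ K′ ≡⁅ i ⁆ → K′ ─ I ≡⁅ j′ ⁆ → K ≡ K′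
    edge-unique fbK fbK′ I─K≡⁅i⁆ K─I≡⁅j⁆ I─K′≡⁅i⁆ K′─I≡⁅j′⁆ = point-injective nondeg fbK fbK′ y≗y′
      where
        u = edge fbI fbK
        u′ = edge fbI fbK′
        α = A[ i ]· u
        α′ = A[ i ]· u′

        α≡α′ : α ≡ α′
        α≡α′ = antisym (edge-leaving-≤ fbK′ fbK I─K′≡⁅i⁆ K′─I≡⁅j′⁆ I─K≡⁅i⁆)
                       (edge-leaving-≤ fbK fbK′ I─K≡⁅i⁆ K─I≡⁅j⁆ I─K′≡⁅i⁆)

        u≗u′ : u ≗ u′
        u≗u′ t = x∙y⁻¹≈ε⇒x≈y _ _ (*-cancelˡ-≢0 (edge-leaving-≢0 fbI fbK nondeg I─K≡⁅i⁆) (begin-equality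
          α * (u t - u′ t)     ≡⟨ x[y-z]≈xy-xz α (u t) (u′ t) ⟩
          α * u t - α * u′ t   ≡⟨ cong (λ c → c * u t - α * u′ t) α≡α′ ⟩
          α′ * u t - α * u′ t  ≡⟨ proportional-edges fbK fbK′ I─K≡⁅i⁆ I─K′≡⁅i⁆ t ⟩
          0#                   ∎))

        y≗y′ : point fbK ≗ point fbK′
        y≗y′ t = +-cancelʳ (- point fbI t) (point fbK t) (point fbK′ t) (u≗u′ t)

  record ConeRays (I : Subset m) : Set where
    field
      ray      : ∀ {l} → l ∈ I → Vector Carrier n
      ray-tight : ∀ {l} (l∈I : l ∈ I) {l′} → l′ ∈ I → l′ ≢ l → A[ l′ ]· ray l∈I ≡ 0#
      ray-nonNeg : ∀ {l} (l∈I : l ∈ I) → 0# ≤ A[ l ]· ray l∈I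
      ray-≢0    : ∀ {l} (l∈I : l ∈ I) → A[ l ]· ray l∈I ≢ 0#

  -- The rays span the cone { w | A_I w ≥ 0 }: w = ∑_{l ∈ I} (A_l w / A_l r_l) r_l.
  nonNeg-on-rays⇒nonNeg-on-cone : ∀ {I} → NonsingularRows A I → (rays : ConeRays I) →
    ∀ {φ} → IsLinear φ → (∀ {l} (l∈I : l ∈ I) → 0# ≤ φ (ConeRays.ray rays l∈I)) →
    ∀ w → (∀ l → l ∈ I → 0# ≤ A[ l ]· w) → 0# ≤ φ w
  nonNeg-on-rays⇒nonNeg-on-cone {I} ns rays {φ} φ-lin φ-ray w Aw≥0 = begin
    0#                    ≤⟨ sum-nonNeg _ (λ l → φ-term (l ∈? I)) ⟩
    sum (λ l → φ (term l)) ≡⟨ ∑ᵥ-homo φ-lin term ⟨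
    φ (∑ᵥ term)           ≡⟨ cong-≗ φ-lin w≗∑term ⟨
    φ w                   ∎
    where
      open ConeRays rays

      coefficient : ∀ {l} → l ∈ I → Carrier
      coefficient {l} l∈I = A[ l ]· w * proj₁ (inverse (A[ l ]· ray l∈I) (ray-≢0 l∈I))

      coefficient-nonNeg : ∀ {l} (l∈I : l ∈ I) → 0# ≤ coefficient l∈I
      coefficient-nonNeg {l} l∈I = *-pos (Aw≥0 l l∈I) (inverse-nonNeg (ray-nonNeg l∈I) (proj₂ (inverse _ (ray-≢0 l∈I))))

      termAt : ∀ {l} → Dec (l ∈ I) → Vector Carrier n
      termAt (yes l∈I) = coefficient l∈I *ₗ ray l∈I
      termAt (no  _)   = 0ᵥ

      term : Fin m → Vector Carrier n
      term l = termAt (l ∈? I)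

      A·term-diagonal : ∀ {l} → l ∈ I → (d : Dec (l ∈ I)) → A[ l ]· termAt d ≡ A[ l ]· w
      A·term-diagonal {l} _ (yes l∈I) = begin-equality
        A[ l ]· (coefficient l∈I *ₗ ray l∈I)     ≡⟨ *ₗ-homo (row·-isLinear A l) _ _ ⟩
        A[ l ]· w * r⁻¹ * A[ l ]· ray l∈I        ≡⟨ *-assoc _ r⁻¹ _ ⟩
        A[ l ]· w * (r⁻¹ * A[ l ]· ray l∈I)      ≡⟨ cong (A[ l ]· w *_) (trans (*-comm r⁻¹ _) (proj₂ inv)) ⟩
        A[ l ]· w * 1#                           ≡⟨ *-identityʳ _ ⟩
        A[ l ]· w                                ∎
        where
          inv = inverse (A[ l ]· ray l∈I) (ray-≢0 l∈I)
          r⁻¹ = proj₁ inv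
      A·term-diagonal l∈I (no l∉I) = contradiction l∈I l∉I

      A·term-offDiagonal : ∀ {l l′} → l′ ∈ I → l′ ≢ l → (d : Dec (l ∈ I)) → A[ l′ ]· termAt d ≡ 0#
      A·term-offDiagonal l′∈I l′≢l (yes l∈I) =
        trans (*ₗ-homo (row·-isLinear A _) _ _) (trans (cong (_ *_) (ray-tight l∈I l′∈I l′≢l)) (zeroʳ _))
      A·term-offDiagonal {l′ = l′} _ _ (no _) = 0-homo (row·-isLinear A l′)

      w≗∑term : w ≗ ∑ᵥ term
      w≗∑term = nonsingular⇒injective ns λ l′ l′∈I → sym (begin-equality
        A[ l′ ]· ∑ᵥ term              ≡⟨ ∑ᵥ-homo (row·-isLinear A l′) term ⟩
        sum (λ l → A[ l′ ]· term l)   ≡⟨ sum-onePoint _ l′ (λ l l≢l′ → A·term-offDiagonal l′∈I (l≢l′ ∘ sym) (l ∈? I)) ⟩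
        A[ l′ ]· term l′              ≡⟨ A·term-diagonal l′∈I (l′ ∈? I) ⟩
        A[ l′ ]· w                    ∎)

      φ-term : ∀ {l} (d : Dec (l ∈ I)) → 0# ≤ φ (termAt d)
      φ-term (yes l∈I) = subst (0# ≤_) (sym (*ₗ-homo φ-lin _ _)) (*-pos (coefficient-nonNeg l∈I) (φ-ray l∈I))
      φ-term (no  _)   = ≤-reflexive (sym (0-homo φ-lin))

  indicatorAt : ∀ {P : Set} → Dec P → Carrier
  indicatorAt (yes _) = 1#
  indicatorAt (no  _) = 0#

  objective : Subset m → Vector Carrier n → Carrier
  objective J x = sum (λ k → indicatorAt (k ∈? J) * A[ k ]· x)

  objective-isLinear : ∀ J → IsLinear (objective J)
  objective-isLinear J = weightedSum-isLinear (λ k → indicatorAt (k ∈? J)) (row·-isLinear A)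

  module _ {J xJ} (xJ-basic : BasicPoint A b J xJ) {x} (x-feasible : InP A b x) where
    private
      slack : ∀ {k} (d : Dec (k ∈ J)) → 0# ≤ indicatorAt d * A[ k ]· (x -ᵥ xJ)
      slack {k} (yes k∈J) = subst (0# ≤_) (sym (trans (*-identityˡ _) (-ᵥ-homo (row·-isLinear A k) x xJ)))
        (x≤y⇒0≤y-x (subst (_≤ A[ k ]· x) (sym (xJ-basic k k∈J)) (x-feasible k)))
      slack (no _) = ≤-reflexive (sym (zeroˡ _))

      objective-difference : objective J (x -ᵥ xJ) ≡ objective J x - objective J xJ
      objective-difference = -ᵥ-homo (objective-isLinear J) x xJ

    objective-minimal : objective J xJ ≤ objective J x
    objective-minimal = 0≤y-x⇒x≤y (subst (0# ≤_) objective-difference (sum-nonNeg _ (λ k → slack (k ∈? J))))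

    objective-≡⇒basic : objective J x ≡ objective J xJ → BasicPoint A b J x
    objective-≡⇒basic obj≡ k k∈J = trans (x∙y⁻¹≈ε⇒x≈y _ _ (tight (k ∈? J) slack-zero)) (xJ-basic k k∈J)
      where
        slack-zero : indicatorAt (k ∈? J) * A[ k ]· (x -ᵥ xJ) ≡ 0#
        slack-zero = sum-nonNeg-≡0 _ (λ k → slack (k ∈? J))
                       (trans objective-difference (x≈y⇒x∙y⁻¹≈ε obj≡)) k
        tight : (d : Dec (k ∈ J)) → indicatorAt d * A[ k ]· (x -ᵥ xJ) ≡ 0# → A[ k ]· x - A[ k ]· xJ ≡ 0#
        tight (yes _)   eq = trans (sym (-ᵥ-homo (row·-isLinear A k) x xJ)) (trans (sym (*-identityˡ _)) eq)
        tight (no  k∉J) _  = contradiction k∈J k∉J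

module RegularGraphOfFeasibleBases
  (F : OrderedField) {m n} (A : Fin m → Fin n → OrderedField.Carrier F) (b : Fin m → OrderedField.Carrier F)
  (nondeg : LP.Nondegenerate F A b) (G : SubsetGraph m)
  (V-feasible : ∀ I → T (SubsetGraph.V G I) → LP.FeasibleBasis F A b I)
  (E-adjacent : ∀ I J → T (SubsetGraph.V G I) → T (SubsetGraph.E G I J) → suc ∣ I ∩ J ∣ ≡ n)
  (V-degree : ∀ I → T (SubsetGraph.V G I) → degree G I ≡ n) where

  open OrderedFieldProperties F
  open LinearAlgebra F
  open LP F using (FeasibleBasis)
  open FeasibleBases F A b
  open SubsetCombinatorics
  open SubsetGraph G
  import Data.Nat as ℕ
  open import Data.Nat.Properties using (≤-<-trans; <-irrefl)
  open import Data.Bool using (T?)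
  open import Data.Fin.Subset using (_∉_) renaming (_-_ to _∖_)
  open import Data.Fin.Subset.Properties using (_∈?_; x∈p∧x≢y⇒x∈p-y; x∈p⇒∣p-x∣<∣p∣)
  open import Data.List using (filter)
  import Data.List.Relation.Unary.All as All
  import Data.List.Relation.Unary.All.Properties as All
  import Data.List.Relation.Unary.Any as Any
  open import Data.List.Relation.Unary.Any using (any?; satisfied)
  import Data.List.Relation.Unary.AllPairs.Properties as AllPairs
  open import Relation.Nullary using (¬?)
  open import Relation.Nullary.Decidable using (_×-dec_; decidable-stable)
  open import Data.Bool.Properties using (T-irrelevant)
  open import Data.List.Membership.Propositional.Properties using (∈-filter⁺)
  open import Data.List.Extrema ≤-totalOrder using (argmin; argmin-all; f[argmin]≤f[xs])

  E⇒V : ∀ {I K} → T (E I K) → T (V K)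
  E⇒V {I} {K} I─K = E-in-V K I (subst T (E-sym I K) I─K)

  ∣V∣≡n : ∀ {I} → T (V I) → ∣ I ∣ ≡ n
  ∣V∣≡n {I} I∈V = proj₁ (proj₁ (V-feasible I I∈V))

  neighbour-exchange : ∀ {I K i} (I∈V : T (V I)) (I─K : T (E I K)) → i ∈ I → i ∉ K →
                       I ─ K ≡⁅ i ⁆ × ∃ (K ─ I ≡⁅_⁆)
  neighbour-exchange {I} {K} I∈V I─K = adjacent⇒exchange (∣V∣≡n I∈V) (∣V∣≡n (E⇒V I─K)) (E-adjacent I K I∈V I─K)

  neighbour-avoiding : ∀ {I i} → T (V I) → i ∈ I → ∃ λ K → T (E I K) × i ∉ K
  neighbour-avoiding {I} {i} I∈V i∈I with any? (λ K → T? (E I K) ×-dec ¬? (i ∈? K)) (allSubsets m)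
  ... | yes found = satisfied found
  ... | no  none  = contradiction (≤-<-trans n≤∣I∖i∣ ∣I∖i∣<n) (<-irrefl refl)
    where
      neighbours = filter (T? ∘ E I) (allSubsets m)

      i∈neighbour : ∀ {K} → T (E I K) → i ∈ K
      i∈neighbour {K} I─K = decidable-stable (i ∈? K)
        (λ i∉K → none (Any.map (λ { refl → I─K , i∉K }) (allSubsets-complete K)))

      Leaves : Subset m → Fin m → Set
      Leaves K l = T (E I K) × I ─ K ≡⁅ l ⁆

      leaving-in-I-i : ∀ {K} → T (E I K) → ∃ λ l → l ∈ I ∖ i × Leaves K l
      leaving-in-I-i {K} I─K with ∣p∣≡1+∣p∩q∣⇒p─q≡⁅i⁆ I K (trans (∣V∣≡n I∈V) (sym (E-adjacent I K I∈V I─K)))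
      ... | l , I─K≡⁅l⁆@(l∈I , l∉K , _) =
        l , x∈p∧x≢y⇒x∈p-y l∈I (λ { refl → l∉K (i∈neighbour I─K) }) , I─K , I─K≡⁅l⁆

      leaving-injective : ∀ {K K′ l} → Leaves K l → Leaves K′ l → K ≡ K′
      leaving-injective {K} {K′} (I─K , I─K≡⁅l⁆@(l∈I , l∉K , _)) (I─K′ , I─K′≡⁅l⁆@(_ , l∉K′ , _)) =
        edge-unique nondeg (V-feasible I I∈V) (V-feasible K (E⇒V I─K)) (V-feasible K′ (E⇒V I─K′))
          I─K≡⁅l⁆ (proj₂ (proj₂ (neighbour-exchange I∈V I─K l∈I l∉K)))
          I─K′≡⁅l⁆ (proj₂ (proj₂ (neighbour-exchange I∈V I─K′ l∈I l∉K′)))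

      n≤∣I∖i∣ : n ℕ.≤ ∣ I ∖ i ∣
      n≤∣I∖i∣ = subst (ℕ._≤ ∣ I ∖ i ∣) (trans (sym (countTrue≡length∘filter (E I) (allSubsets m))) (V-degree I I∈V))
        (pigeonhole-length≤∣S∣ (I ∖ i) Leaves (AllPairs.filter⁺ (T? ∘ E I) (allSubsets-distinct m))
          (All.map leaving-in-I-i (All.all-filter (T? ∘ E I) (allSubsets m))) leaving-injective)

      ∣I∖i∣<n : ∣ I ∖ i ∣ ℕ.< n
      ∣I∖i∣<n = subst (∣ I ∖ i ∣ ℕ.<_) (∣V∣≡n I∈V) (x∈p⇒∣p-x∣<∣p∣ i∈I)

  vertexObjective : Subset m → Subset m → Carrier
  vertexObjective J K with T? (V K)
  ... | yes K∈V = objective J (point (V-feasible K K∈V))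
  ... | no  _   = 0#

  vertexObjective-≡ : ∀ J {K} (K∈V : T (V K)) → vertexObjective J K ≡ objective J (point (V-feasible K K∈V))
  vertexObjective-≡ J {K} K∈V with T? (V K)
  ... | yes K∈V′ = cong (λ K∈V → objective J (point (V-feasible K K∈V))) (T-irrelevant K∈V′ K∈V)
  ... | no  K∉V  = contradiction K∈V K∉V

  locally-optimal⇒optimal : ∀ {I J} (I∈V : T (V I)) (fbJ : FeasibleBasis A b J) →
    (∀ {K} (I─K : T (E I K)) →
       objective J (point (V-feasible I I∈V)) ≤ objective J (point (V-feasible K (E⇒V I─K)))) →
    I ≡ J
  locally-optimal⇒optimal {I} {J} I∈V fbJ local =
    nondeg I J x fbI fbJ (point-basic fbI) (objective-≡⇒basic (point-basic fbJ) (point-feasible fbI) obj[x]≡obj[xJ])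
    where
      fbI = V-feasible I I∈V
      x = point fbI

      module Neighbour {l} (l∈I : l ∈ I) where
        K = proj₁ (neighbour-avoiding I∈V l∈I)
        I─K = proj₁ (proj₂ (neighbour-avoiding I∈V l∈I))
        fbK = V-feasible K (E⇒V I─K)
        I─K≡⁅l⁆ = proj₁ (neighbour-exchange I∈V I─K l∈I (proj₂ (proj₂ (neighbour-avoiding I∈V l∈I))))

      rays : ConeRays I
      rays = record
        { ray        = λ l∈I → edge fbI (Neighbour.fbK l∈I)
        ; ray-tight  = λ l∈I → edge-tight-except fbI (Neighbour.fbK l∈I) (Neighbour.I─K≡⁅l⁆ l∈I)
        ; ray-nonNeg = λ l∈I → edge-nonNeg fbI (Neighbour.fbK l∈I) l∈I
        ; ray-≢0     = λ l∈I → edge-leaving-≢0 fbI (Neighbour.fbK l∈I) nondeg (Neighbour.I─K≡⁅l⁆ l∈I)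
        }

      objective-nonNeg-on-edges : ∀ {K} (fbK : FeasibleBasis A b K) → objective J x ≤ objective J (point fbK) →
                                  0# ≤ objective J (edge fbI fbK)
      objective-nonNeg-on-edges fbK ≤obj = subst (0# ≤_) (sym (-ᵥ-homo (objective-isLinear J) _ _)) (x≤y⇒0≤y-x ≤obj)

      0≤obj[xJ-x] : 0# ≤ objective J (edge fbI fbJ)
      0≤obj[xJ-x] = nonNeg-on-rays⇒nonNeg-on-cone (nonsingular fbI) rays (objective-isLinear J)
        (λ l∈I → objective-nonNeg-on-edges (Neighbour.fbK l∈I) (local (Neighbour.I─K l∈I)))
        (edge fbI fbJ) (λ l l∈I → edge-nonNeg fbI fbJ l∈I)

      obj[x]≡obj[xJ] : objective J x ≡ objective J (point fbJ)
      obj[x]≡obj[xJ] = antisym (0≤y-x⇒x≤y (subst (0# ≤_) (-ᵥ-homo (objective-isLinear J) _ _) 0≤obj[xJ-x]))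
                               (objective-minimal (point-basic fbJ) (point-feasible fbI))

  feasible⇒vertex : ∃ (T ∘ V) → ∀ {J} → FeasibleBasis A b J → T (V J)
  feasible⇒vertex (I₀ , I₀∈V) {J} fbJ = subst (T ∘ V) (locally-optimal⇒optimal I∈V fbJ local) I∈V
    where
      vertices = filter (T? ∘ V) (allSubsets m)
      I = argmin (vertexObjective J) I₀ vertices

      I∈V : T (V I)
      I∈V = argmin-all (vertexObjective J) I₀∈V (All.all-filter (T? ∘ V) (allSubsets m))

      local : ∀ {K} (I─K : T (E I K)) →
              objective J (point (V-feasible I I∈V)) ≤ objective J (point (V-feasible K (E⇒V I─K)))
      local {K} I─K = begin
        objective J (point (V-feasible I I∈V))        ≡⟨ vertexObjective-≡ J I∈V ⟨
        vertexObjective J I                           ≤⟨ All.lookup (f[argmin]≤f[xs] I₀ vertices)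
                                                           (∈-filter⁺ (T? ∘ V) (allSubsets-complete K) (E⇒V I─K)) ⟩
        vertexObjective J K                           ≡⟨ vertexObjective-≡ J (E⇒V I─K) ⟩
        objective J (point (V-feasible K (E⇒V I─K)))  ∎

  adjacent⇒edge : ∃ (T ∘ V) → ∀ {I J} → FeasibleBasis A b I → FeasibleBasis A b J → suc ∣ I ∩ J ∣ ≡ n → T (E I J)
  adjacent⇒edge nonempty {I} {J} fbI fbJ 1+∣I∩J∣≡n = subst (T ∘ E I) K≡J I─K
    where
      I∈V = feasible⇒vertex nonempty fbI
      leaving = ∣p∣≡1+∣p∩q∣⇒p─q≡⁅i⁆ I J (trans (proj₁ (proj₁ fbI)) (sym 1+∣I∩J∣≡n))
      i∈I = proj₁ (proj₂ leaving)
      i∉J = proj₁ (proj₂ (proj₂ leaving))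
      neighbour = neighbour-avoiding I∈V i∈I
      K = proj₁ neighbour
      I─K = proj₁ (proj₂ neighbour)
      exchange-K = neighbour-exchange I∈V I─K i∈I (proj₂ (proj₂ neighbour))
      exchange-J = adjacent⇒exchange (proj₁ (proj₁ fbI)) (proj₁ (proj₁ fbJ)) 1+∣I∩J∣≡n i∈I i∉J

      K≡J : K ≡ J
      K≡J = edge-unique nondeg (V-feasible I I∈V) (V-feasible K (E⇒V I─K)) fbJ
              (proj₁ exchange-K) (proj₂ (proj₂ exchange-K)) (proj₁ exchange-J) (proj₂ (proj₂ exchange-J))

theorem1 : (F : OrderedField) → let open LP F in
    ∀ {m n} (A : Fin m → Fin n → Carrier) (b : Fin m → Carrier) →
    Bounded A b → Nondegenerate A b → (G : SubsetGraph m) →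
    (∃ λ I → T (SubsetGraph.V G I)) →
    (∀ I → T (SubsetGraph.V G I) → FeasibleBasis A b I) →
    (∀ I J → T (SubsetGraph.V G I) → T (SubsetGraph.E G I J) → suc ∣ I ∩ J ∣ ≡ n) →
    (∀ I → T (SubsetGraph.V G I) → degree G I ≡ n) →
    (∀ I → T (SubsetGraph.V G I) ⇔ FeasibleBasis A b I)
      × (∀ I J → T (SubsetGraph.E G I J) ⇔ (FeasibleBasis A b I × FeasibleBasis A b J × (suc ∣ I ∩ J ∣ ≡ n)))
theorem1 F A b _ nondeg G nonempty V-feasible E-adjacent V-degree =
  (λ I → mk⇔ (V-feasible I) (feasible⇒vertex nonempty)) ,
  (λ I J → mk⇔ (λ I─J → V-feasible I (E-in-V I J I─J) , V-feasible J (E⇒V I─J) , E-adjacent I J (E-in-V I J I─J) I─J)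
               (λ (fbI , fbJ , 1+∣I∩J∣≡n) → adjacent⇒edge nonempty fbI fbJ 1+∣I∩J∣≡n))
  where
    open SubsetGraph G using (E-in-V)
    open RegularGraphOfFeasibleBases F A b nondeg G V-feasible E-adjacent V-degree
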